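{- Let $L_\infty(z)=\sum_{n\ge0}\ell_n z^n$, where $\ell_n$ is the number of $\lambda$-terms (in de Bruijn notation) of size $n$. Then \[ L_\infty(z)=\frac{(1-z)^{3/2}-\sqrt{1-3z-z^2-z^3}}{2z\sqrt{1-z}}. \]
   Context: $\lambda$-terms in de Bruijn notation are generated by the grammar $T ::= \underline{\mathsf{n}} \mid \lambda T \mid T\,T$, where de Bruijn indices $\underline{\mathsf{n}}$ are generated by $\underline{\mathsf{0}}$ and $S\,\underline{\mathsf{n}}$. Size: $|\lambda N|=|N|+1$, $|N\,M|=|N|+|M|+1$, $|S\,\underline{\mathsf{n}}|=|\underline{\mathsf{n}}|+1$, $|\underline{\mathsf{0}}|=1$. -}

module Defs where

open import Data.Nat using (ℕ; zero; suc; _+_; _∸_)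
open import Data.Integer using (+_; -[1+_])
open import Data.Rational using (ℚ; 0ℚ; 1ℚ; ½; _/_) renaming (_+_ to _+q_; _*_ to _*q_; _-_ to _-q_)
open import Data.List using (List; []; _∷_; map; upTo; foldr)
open import Data.Product using (Σ)
open import Relation.Binary.PropositionalEquality using (_≡_)

data Idx : Set where
  𝟘 : Idx
  S : Idx → Idx

data Term : Set where
  var : Idx → Term
  lam : Term → Term
  app : Term → Term → Term

sizeIdx : Idx → ℕ
sizeIdx 𝟘     = 1
sizeIdx (S n) = sizeIdx n + 1

size : Term → ℕ
size (var n)   = sizeIdx n
size (lam t)   = size t + 1
size (app t u) = size t + size u + 1

TermsOfSize : ℕ → Set
TermsOfSize n = Σ Term (λ t → size t ≡ n)

FPS : Set
FPS = ℕ → ℚ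

_≈ₛ_ : FPS → FPS → Set
f ≈ₛ g = ∀ n → f n ≡ g n

_⊕_ : FPS → FPS → FPS
(f ⊕ g) n = f n +q g n

_⊖_ : FPS → FPS → FPS
(f ⊖ g) n = f n -q g n

sumℚ : List ℚ → ℚ
sumℚ = foldr _+q_ 0ℚ

_⊛_ : FPS → FPS → FPS
(f ⊛ g) n = sumℚ (map (λ i → f i *q g (n ∸ i)) (upTo (suc n)))

-- polynomial from its list of coefficients (constant term first)
poly : List ℚ → FPS
poly []       n       = 0ℚ
poly (c ∷ cs) zero    = c
poly (c ∷ cs) (suc n) = poly cs n

oneS : FPS
oneS = poly (1ℚ ∷ [])

oneMinusZ : FPS
oneMinusZ = poly (1ℚ ∷ (-[1+ 0 ] / 1) ∷ [])

P : FPS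
P = poly (1ℚ ∷ (-[1+ 2 ] / 1) ∷ (-[1+ 0 ] / 1) ∷ (-[1+ 0 ] / 1) ∷ [])

constS : ℚ → FPS
constS c = poly (c ∷ [])

module Submission where

-- A term of size n+1 is the variable of that size, λN with |N| = n, or N M with
-- |N| + |M| = n; so ℓ 0 = 0, ℓ (n+1) = 1 + ℓ n + Σ_{i≤n} ℓ i ℓ (n-i), that is
-- L∞ = z (1/(1-z) + L∞ + L∞²).  Multiplying by 1-z gives the quadratic equation
-- (1-z)² L = z + z(1-z) L², whose discriminant identity (1-z)(1-z-2zL)² = 1-3z-z²-z³
-- shows that s(1-z-2zL) is a square root of 1-3z-z²-z³ when s² = 1-z.  Square roots
-- with the same non-zero constant term coincide, so for t = √(1-3z-z²-z³) and v = 1/s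
-- we get v((1-z)s - t) = 2zL, which is the closed form.

open import Defs
open import Data.Nat using (ℕ; zero; suc; _+_; _*_; _∸_; _<_; _≤_; z≤n; s≤s)
import Data.Nat.Properties as ℕₚ
open import Data.Nat.Induction using (<-rec)
import Data.Nat.Coprimality as Coprimality
open import Data.Integer as ℤ using (+_; -[1+_])
import Data.Integer.Properties as ℤₚ
open import Data.Rational using (ℚ; 0ℚ; 1ℚ; ½; _/_; -_; 1/_; ≢-nonZero)
  renaming (_+_ to _+q_; _*_ to _*q_; _-_ to _-q_)
import Data.Rational.Properties as ℚₚ
import Data.Rational.Solver as ℚSolver
open import Data.List using (List; []; _∷_; map; applyUpTo)
open import Data.Maybe using (Maybe; just; nothing)
open import Data.Fin using (Fin)
open import Data.Fin.Properties using (+↔⊎; *↔×; 1↔⊤)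
open import Data.Fin.Permutation using (↔⇒≡)
open import Data.Product using (Σ; _×_; _,_; proj₁; proj₂)
open import Data.Sum using (_⊎_; inj₁; inj₂)
open import Data.Unit using (⊤; tt)
open import Data.Empty using (⊥-elim)
open import Function.Base using (_∘_)
open import Function.Bundles using (_↔_; mk↔ₛ′)
open import Function.Properties.Inverse using (↔-sym; ↔-trans)
open import Data.Sum.Function.Propositional using (_⊎-↔_)
open import Data.Product.Function.NonDependent.Propositional using (_×-↔_)
open import Relation.Nullary using (yes; no)
open import Relation.Binary.PropositionalEquality
open import Algebra.Bundles using (RawRing; CommutativeRing)
open import Algebra.Solver.Ring.AlmostCommutativeRing
  using (AlmostCommutativeRing; _-Raw-AlmostCommutative⟶_)
import Algebra.Construct.Pointwise as Pointwise
import Algebra.Solver.Ring as RingSolver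
import Relation.Binary.Reasoning.Setoid
open import Algebra.Properties.Group ℚₚ.+-0-group using (x∙y⁻¹≈ε⇒x≈y)

-- Σ_{i<n} h i, unfolded from the front so that shifting the index is definitional.
sumTo : ℕ → (ℕ → ℚ) → ℚ
sumTo zero    h = 0ℚ
sumTo (suc n) h = h 0 +q sumTo n (λ i → h (suc i))

sumTo-applyUpTo : ∀ n (f : ℕ → ℕ) (h : ℕ → ℚ) →
                  sumℚ (map h (applyUpTo f n)) ≡ sumTo n (λ i → h (f i))
sumTo-applyUpTo zero    f h = refl
sumTo-applyUpTo (suc n) f h = cong (h (f 0) +q_) (sumTo-applyUpTo n (f ∘ suc) h)

sumTo-cong : ∀ n {h k : ℕ → ℚ} → (∀ i → i < n → h i ≡ k i) → sumTo n h ≡ sumTo n k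
sumTo-cong zero    eq = refl
sumTo-cong (suc n) eq = cong₂ _+q_ (eq 0 (s≤s z≤n)) (sumTo-cong n (λ i i<n → eq (suc i) (s≤s i<n)))

sumTo-zero : ∀ n (h : ℕ → ℚ) → (∀ i → i < n → h i ≡ 0ℚ) → sumTo n h ≡ 0ℚ
sumTo-zero zero    h eq = refl
sumTo-zero (suc n) h eq =
  cong₂ _+q_ (eq 0 (s≤s z≤n)) (sumTo-zero n (λ i → h (suc i)) (λ i i<n → eq (suc i) (s≤s i<n)))

sumTo-+ : ∀ n (h k : ℕ → ℚ) → sumTo n (λ i → h i +q k i) ≡ sumTo n h +q sumTo n k
sumTo-+ zero    h k = refl
sumTo-+ (suc n) h k =
  trans (cong (h 0 +q k 0 +q_) (sumTo-+ n (λ i → h (suc i)) (λ i → k (suc i))))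
        (solve 4 (λ a b c d → (a :+ b) :+ (c :+ d) := (a :+ c) :+ (b :+ d)) refl
               (h 0) (k 0) (sumTo n (λ i → h (suc i))) (sumTo n (λ i → k (suc i))))
  where open ℚSolver.+-*-Solver

sumTo-*ˡ : ∀ n c (h : ℕ → ℚ) → sumTo n (λ i → c *q h i) ≡ c *q sumTo n h
sumTo-*ˡ zero    c h = sym (ℚₚ.*-zeroʳ c)
sumTo-*ˡ (suc n) c h =
  trans (cong (c *q h 0 +q_) (sumTo-*ˡ n c (λ i → h (suc i)))) (sym (ℚₚ.*-distribˡ-+ c (h 0) _))

sumTo-neg : ∀ n (h : ℕ → ℚ) → sumTo n (λ i → - h i) ≡ - sumTo n h
sumTo-neg zero    h = refl
sumTo-neg (suc n) h =
  trans (cong (- h 0 +q_) (sumTo-neg n (λ i → h (suc i)))) (sym (ℚₚ.neg-distrib-+ (h 0) _))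

sumTo-last : ∀ n (h : ℕ → ℚ) → sumTo (suc n) h ≡ sumTo n h +q h n
sumTo-last zero    h = trans (ℚₚ.+-identityʳ (h 0)) (sym (ℚₚ.+-identityˡ (h 0)))
sumTo-last (suc n) h = trans (cong (h 0 +q_) (sumTo-last n (λ i → h (suc i)))) (sym (ℚₚ.+-assoc (h 0) _ _))

-- the coefficients of f ⊛ g, written with sumTo so that they unfold by recursion
conv : FPS → FPS → FPS
conv f g n = sumTo (suc n) (λ i → f i *q g (n ∸ i))

⊛≡conv : ∀ f g n → (f ⊛ g) n ≡ conv f g n
⊛≡conv f g n = sumTo-applyUpTo (suc n) (λ i → i) (λ i → f i *q g (n ∸ i))

shift : FPS → FPS
shift f i = f (suc i)

zeroS : FPS
zeroS _ = 0ℚ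

negS : FPS → FPS
negS f n = - f n

conv-cong : ∀ {f f′ g g′} → f ≈ₛ f′ → g ≈ₛ g′ → ∀ n → conv f g n ≡ conv f′ g′ n
conv-cong f≈f′ g≈g′ n = sumTo-cong (suc n) (λ i _ → cong₂ _*q_ (f≈f′ i) (g≈g′ (n ∸ i)))

conv-scaleˡ : ∀ c f g n → conv (λ i → c *q f i) g n ≡ c *q conv f g n
conv-scaleˡ c f g n =
  trans (sumTo-cong (suc n) (λ i _ → ℚₚ.*-assoc c (f i) (g (n ∸ i))))
        (sumTo-*ˡ (suc n) c (λ i → f i *q g (n ∸ i)))

conv-distribʳ : ∀ f f′ g n → conv (f ⊕ f′) g n ≡ conv f g n +q conv f′ g n
conv-distribʳ f f′ g n =
  trans (sumTo-cong (suc n) (λ i _ → ℚₚ.*-distribʳ-+ (g (n ∸ i)) (f i) (f′ i)))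
        (sumTo-+ (suc n) (λ i → f i *q g (n ∸ i)) (λ i → f′ i *q g (n ∸ i)))

conv-zeroˡ : ∀ g n → conv zeroS g n ≡ 0ℚ
conv-zeroˡ g n = sumTo-zero (suc n) (λ i → 0ℚ *q g (n ∸ i)) (λ i _ → ℚₚ.*-zeroˡ (g (n ∸ i)))

conv-negˡ : ∀ f g n → conv (negS f) g n ≡ - conv f g n
conv-negˡ f g n =
  trans (sumTo-cong (suc n) (λ i _ → sym (ℚₚ.neg-distribˡ-* (f i) (g (n ∸ i)))))
        (sumTo-neg (suc n) (λ i → f i *q g (n ∸ i)))

conv-sucʳ : ∀ f g n → conv f g (suc n) ≡ conv f (shift g) n +q f (suc n) *q g 0
conv-sucʳ f g n =
  trans (sumTo-last (suc n) (λ i → f i *q g (suc n ∸ i)))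
        (cong₂ _+q_ (sumTo-cong (suc n) (λ i i<1+n → cong (λ k → f i *q g k) (ℕₚ.+-∸-assoc 1 (ℕₚ.m<1+n⇒m≤n i<1+n))))
                    (cong (λ k → f (suc n) *q g k) (ℕₚ.n∸n≡0 n)))

conv-comm : ∀ f g n → conv f g n ≡ conv g f n
conv-comm f g zero    = cong (_+q 0ℚ) (ℚₚ.*-comm (f 0) (g 0))
conv-comm f g (suc n) = begin
  f 0 *q g (suc n) +q conv (shift f) g n ≡⟨ cong (f 0 *q g (suc n) +q_) (conv-comm (shift f) g n) ⟩
  f 0 *q g (suc n) +q conv g (shift f) n ≡⟨ ℚₚ.+-comm (f 0 *q g (suc n)) _ ⟩
  conv g (shift f) n +q f 0 *q g (suc n) ≡⟨ cong (conv g (shift f) n +q_) (ℚₚ.*-comm (f 0) (g (suc n))) ⟩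
  conv g (shift f) n +q g (suc n) *q f 0 ≡⟨ sym (conv-sucʳ g f n) ⟩
  conv g f (suc n)                       ∎
  where open ≡-Reasoning

conv-identityˡ : ∀ f n → conv oneS f n ≡ f n
conv-identityˡ f zero    = trans (ℚₚ.+-identityʳ (1ℚ *q f 0)) (ℚₚ.*-identityˡ (f 0))
conv-identityˡ f (suc n) =
  trans (cong₂ _+q_ (ℚₚ.*-identityˡ (f (suc n))) (conv-zeroˡ f n)) (ℚₚ.+-identityʳ (f (suc n)))

conv-assoc : ∀ f g h n → conv (conv f g) h n ≡ conv f (conv g h) n
conv-assoc f g h zero = solve 3 (λ a b c → ((a :* b :+ con 0ℚ) :* c) :+ con 0ℚ := a :* (b :* c :+ con 0ℚ) :+ con 0ℚ)
                              refl (f 0) (g 0) (h 0)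
  where open ℚSolver.+-*-Solver
conv-assoc f g h (suc n) = begin
  conv f g 0 *q h (suc n) +q conv (λ i → f 0 *q g (suc i) +q conv (shift f) g i) h n
    ≡⟨ cong (conv f g 0 *q h (suc n) +q_) (conv-distribʳ (λ i → f 0 *q g (suc i)) (conv (shift f) g) h n) ⟩
  conv f g 0 *q h (suc n) +q (conv (λ i → f 0 *q g (suc i)) h n +q conv (conv (shift f) g) h n)
    ≡⟨ cong₂ (λ x y → conv f g 0 *q h (suc n) +q (x +q y)) (conv-scaleˡ (f 0) (shift g) h n) (conv-assoc (shift f) g h n) ⟩
  conv f g 0 *q h (suc n) +q (f 0 *q conv (shift g) h n +q conv (shift f) (conv g h) n)
    ≡⟨ solve 5 (λ a b c x y → (a :* b :+ con 0ℚ) :* c :+ (a :* x :+ y) := a :* (b :* c :+ x) :+ y) refl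
             (f 0) (g 0) (h (suc n)) (conv (shift g) h n) (conv (shift f) (conv g h) n) ⟩
  conv f (conv g h) (suc n) ∎
  where
  open ≡-Reasoning
  open ℚSolver.+-*-Solver

⊛-cong : ∀ {f f′ g g′} → f ≈ₛ f′ → g ≈ₛ g′ → (f ⊛ g) ≈ₛ (f′ ⊛ g′)
⊛-cong {f} {f′} {g} {g′} f≈f′ g≈g′ n =
  trans (⊛≡conv f g n) (trans (conv-cong f≈f′ g≈g′ n) (sym (⊛≡conv f′ g′ n)))

⊛-comm : ∀ f g → (f ⊛ g) ≈ₛ (g ⊛ f)
⊛-comm f g n = trans (⊛≡conv f g n) (trans (conv-comm f g n) (sym (⊛≡conv g f n)))

⊛-assoc : ∀ f g h → ((f ⊛ g) ⊛ h) ≈ₛ (f ⊛ (g ⊛ h))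
⊛-assoc f g h n = begin
  ((f ⊛ g) ⊛ h) n       ≡⟨ ⊛≡conv (f ⊛ g) h n ⟩
  conv (f ⊛ g) h n      ≡⟨ conv-cong {g = h} (⊛≡conv f g) (λ _ → refl) n ⟩
  conv (conv f g) h n   ≡⟨ conv-assoc f g h n ⟩
  conv f (conv g h) n   ≡⟨ conv-cong {f} (λ _ → refl) (λ i → sym (⊛≡conv g h i)) n ⟩
  conv f (g ⊛ h) n      ≡⟨ sym (⊛≡conv f (g ⊛ h) n) ⟩
  (f ⊛ (g ⊛ h)) n       ∎
  where open ≡-Reasoning

⊛-identityˡ : ∀ f → (oneS ⊛ f) ≈ₛ f
⊛-identityˡ f n = trans (⊛≡conv oneS f n) (conv-identityˡ f n)

⊛-distribʳ : ∀ h f g → ((f ⊕ g) ⊛ h) ≈ₛ ((f ⊛ h) ⊕ (g ⊛ h))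
⊛-distribʳ h f g n =
  trans (⊛≡conv (f ⊕ g) h n)
        (trans (conv-distribʳ f g h n) (sym (cong₂ _+q_ (⊛≡conv f h n) (⊛≡conv g h n))))

⊛-zeroˡ : ∀ f → (zeroS ⊛ f) ≈ₛ zeroS
⊛-zeroˡ f n = trans (⊛≡conv zeroS f n) (conv-zeroˡ f n)

⊛-negˡ : ∀ f g → (negS f ⊛ g) ≈ₛ negS (f ⊛ g)
⊛-negˡ f g n = trans (⊛≡conv (negS f) g n) (trans (conv-negˡ f g n) (cong -_ (sym (⊛≡conv f g n))))

FPS-ring : AlmostCommutativeRing _ _
FPS-ring = record
  { Carrier = FPS ; _≈_ = _≈ₛ_ ; _+_ = _⊕_ ; _*_ = _⊛_ ; -_ = negS ; 0# = zeroS ; 1# = oneS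
  ; isAlmostCommutativeRing = record
    { isCommutativeSemiring = record
      { isSemiring = record
        { isSemiringWithoutAnnihilatingZero = record
          { +-isCommutativeMonoid = Pointwise.isCommutativeMonoid ℕ ℚₚ.+-0-isCommutativeMonoid
          ; *-cong     = ⊛-cong
          ; *-assoc    = ⊛-assoc
          ; *-identity = ⊛-identityˡ , (λ f n → trans (⊛-comm f oneS n) (⊛-identityˡ f n))
          ; distrib    = (λ h f g n → trans (⊛-comm h (f ⊕ g) n)
                                     (trans (⊛-distribʳ h f g n) (cong₂ _+q_ (⊛-comm f h n) (⊛-comm g h n))))
                       , ⊛-distribʳ
          }
        ; zero = ⊛-zeroˡ , (λ f n → trans (⊛-comm f zeroS n) (⊛-zeroˡ f n))
        }
      ; *-comm = ⊛-comm
      }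
    ; -‿cong       = λ f≈g n → cong -_ (f≈g n)
    ; -‿*-distribˡ = ⊛-negˡ
    ; -‿+-comm     = λ f g n → sym (ℚₚ.neg-distrib-+ (f n) (g n))
    }
  }

constS-scale : ∀ a g n → (constS a ⊛ g) n ≡ a *q g n
constS-scale a g zero    = trans (⊛≡conv (constS a) g 0) (ℚₚ.+-identityʳ (a *q g 0))
constS-scale a g (suc n) =
  trans (⊛≡conv (constS a) g (suc n))
        (trans (cong (a *q g (suc n) +q_) (conv-zeroˡ g n)) (ℚₚ.+-identityʳ _))

ℚ-rawRing : RawRing _ _
ℚ-rawRing = CommutativeRing.rawRing ℚₚ.+-*-commutativeRing

-- Rational constants embed as constant series; this lets the solver use coefficients.
constS-morphism : ℚ-rawRing -Raw-AlmostCommutative⟶ FPS-ring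
constS-morphism = record
  { ⟦_⟧    = constS
  ; +-homo = λ { a b zero → refl ; a b (suc n) → refl }
  ; *-homo = λ { a b zero → sym (constS-scale a (constS b) 0)
               ; a b (suc n) → sym (trans (constS-scale a (constS b) (suc n)) (ℚₚ.*-zeroʳ a)) }
  ; -‿homo = λ { a zero → refl ; a (suc n) → refl }
  ; 0-homo = λ { zero → refl ; (suc n) → refl }
  ; 1-homo = λ { zero → refl ; (suc n) → refl }
  }

-- equality of coefficients is decidable, so the solver can discard zero terms
constS-equal? : ∀ a b → Maybe (constS a ≈ₛ constS b)
constS-equal? a b with a ℚₚ.≟ b
... | yes refl = just (λ _ → refl)
... | no _     = nothing

module FPS-Solver = RingSolver ℚ-rawRing FPS-ring constS-morphism constS-equal?

module ≈ₛ-Reasoning = Relation.Binary.Reasoning.Setoid (AlmostCommutativeRing.setoid FPS-ring)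

z : FPS
z = poly (0ℚ ∷ 1ℚ ∷ [])

G : FPS
G _ = 1ℚ

z⊛-zero : ∀ f → (z ⊛ f) 0 ≡ 0ℚ
z⊛-zero f = trans (⊛≡conv z f 0) (trans (ℚₚ.+-identityʳ (0ℚ *q f 0)) (ℚₚ.*-zeroˡ (f 0)))

z⊛-suc : ∀ f n → (z ⊛ f) (suc n) ≡ f n
z⊛-suc f n =
  trans (⊛≡conv z f (suc n))
        (trans (cong₂ _+q_ (ℚₚ.*-zeroˡ (f (suc n))) (conv-identityˡ f n)) (ℚₚ.+-identityˡ (f n)))

horner : List ℚ → FPS
horner []       = constS 0ℚ
horner (c ∷ cs) = constS c ⊕ (z ⊛ horner cs)

poly≈horner : ∀ cs → poly cs ≈ₛ horner cs
poly≈horner []       zero    = refl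
poly≈horner []       (suc n) = refl
poly≈horner (c ∷ cs) zero    = sym (trans (cong (c +q_) (z⊛-zero (horner cs))) (ℚₚ.+-identityʳ c))
poly≈horner (c ∷ cs) (suc n) =
  sym (trans (ℚₚ.+-identityˡ _) (trans (z⊛-suc (horner cs) n) (sym (poly≈horner cs n))))

geometric-inverse : ((oneS ⊖ z) ⊛ G) ≈ₛ oneS
geometric-inverse n = trans (⊛-distribʳ G oneS (negS z) n)
                            (trans (cong₂ _+q_ (⊛-identityˡ G n) (⊛-negˡ z G n)) (coefficient n))
  where
  coefficient : ∀ n → G n +q - (z ⊛ G) n ≡ oneS n
  coefficient zero    rewrite z⊛-zero G  = refl
  coefficient (suc n) rewrite z⊛-suc G n = refl

*-eq-0-cancelʳ : ∀ {x y} → y ≢ 0ℚ → x *q y ≡ 0ℚ → x ≡ 0ℚ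
*-eq-0-cancelʳ {x} {y} y≢0 xy≡0 = begin
  x                    ≡⟨ sym (ℚₚ.*-identityʳ x) ⟩
  x *q 1ℚ              ≡⟨ cong (x *q_) (sym (ℚₚ.*-inverseʳ y)) ⟩
  x *q (y *q 1/ y)     ≡⟨ sym (ℚₚ.*-assoc x y (1/ y)) ⟩
  (x *q y) *q 1/ y     ≡⟨ cong (_*q 1/ y) xy≡0 ⟩
  0ℚ *q 1/ y           ≡⟨ ℚₚ.*-zeroˡ (1/ y) ⟩
  0ℚ                   ∎
  where
  instance _ = ≢-nonZero y≢0
  open ≡-Reasoning

-- A series with non-zero constant term is not a zero divisor: by strong
-- induction, the coefficient n of d ⊛ e is d n · e 0 plus terms that vanish.
nonzero-constant-cancel : ∀ d e → e 0 ≢ 0ℚ → (d ⊛ e) ≈ₛ zeroS → d ≈ₛ zeroS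
nonzero-constant-cancel d e e0≢0 de≈0 = <-rec (λ n → d n ≡ 0ℚ) step
  where
  step : ∀ n → (∀ {i} → i < n → d i ≡ 0ℚ) → d n ≡ 0ℚ
  step n below = *-eq-0-cancelʳ e0≢0 (begin
    d n *q e 0                                              ≡⟨ cong (λ k → d n *q e k) (sym (ℕₚ.n∸n≡0 n)) ⟩
    d n *q e (n ∸ n)                                        ≡⟨ sym (ℚₚ.+-identityˡ _) ⟩
    0ℚ +q d n *q e (n ∸ n)                                  ≡⟨ cong (_+q d n *q e (n ∸ n)) (sym earlier-vanish) ⟩
    sumTo n (λ i → d i *q e (n ∸ i)) +q d n *q e (n ∸ n)    ≡⟨ sym (sumTo-last n (λ i → d i *q e (n ∸ i))) ⟩
    conv d e n                                              ≡⟨ sym (⊛≡conv d e n) ⟩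
    (d ⊛ e) n                                               ≡⟨ de≈0 n ⟩
    0ℚ                                                      ∎)
    where
    open ≡-Reasoning
    earlier-vanish : sumTo n (λ i → d i *q e (n ∸ i)) ≡ 0ℚ
    earlier-vanish = sumTo-zero n _ (λ i i<n → trans (cong (_*q e (n ∸ i)) (below i<n)) (ℚₚ.*-zeroˡ (e (n ∸ i))))

-- f² = g² factors as (f - g)(f + g) = 0, and f + g is cancellable.
sqrt-unique : ∀ f g → (f ⊛ f) ≈ₛ (g ⊛ g) → f 0 +q g 0 ≢ 0ℚ → f ≈ₛ g
sqrt-unique f g f²≈g² f0+g0≢0 n =
  x∙y⁻¹≈ε⇒x≈y (f n) (g n) (nonzero-constant-cancel (f ⊖ g) (f ⊕ g) f0+g0≢0 difference n)
  where
  open FPS-Solver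
  open ≈ₛ-Reasoning
  difference : ((f ⊖ g) ⊛ (f ⊕ g)) ≈ₛ zeroS
  difference = begin
    (f ⊖ g) ⊛ (f ⊕ g) ≈⟨ solve 2 (λ a b → (a :- b) :* (a :+ b) := (a :* a) :- (b :* b)) (λ _ → refl) f g ⟩
    (f ⊛ f) ⊖ (g ⊛ g) ≈⟨ (λ n → cong (_-q (g ⊛ g) n) (f²≈g² n)) ⟩
    (g ⊛ g) ⊖ (g ⊛ g) ≈⟨ (λ n → ℚₚ.+-inverseʳ ((g ⊛ g) n)) ⟩
    zeroS             ∎

⊛-at-zero : ∀ f g → (f ⊛ g) 0 ≡ f 0 *q g 0
⊛-at-zero f g = trans (⊛≡conv f g 0) (ℚₚ.+-identityʳ (f 0 *q g 0))

oneMinusZ≈1-z : oneMinusZ ≈ₛ (oneS ⊖ z)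
oneMinusZ≈1-z zero          = refl
oneMinusZ≈1-z (suc zero)    = refl
oneMinusZ≈1-z (suc (suc n)) = refl

module FunctionalEquation (L : FPS) (L-eq : L ≈ₛ (z ⊛ ((G ⊕ L) ⊕ (L ⊛ L)))) where
  open FPS-Solver

  quadratic : (((oneS ⊖ z) ⊛ (oneS ⊖ z)) ⊛ L) ≈ₛ (z ⊕ (((z ⊛ (oneS ⊖ z)) ⊛ L) ⊛ L))
  quadratic = begin
    ((oneS ⊖ z) ⊛ (oneS ⊖ z)) ⊛ L
      ≈⟨ solve 2 (λ Z l → ((con 1ℚ :- Z) :* (con 1ℚ :- Z)) :* l := ((con 1ℚ :- Z) :* l) :- (Z :* ((con 1ℚ :- Z) :* l)))
               (λ _ → refl) z L ⟩
    A ⊖ (z ⊛ A)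
      ≈⟨ (λ n → cong (_-q (z ⊛ A) n) (A-expanded n)) ⟩
    (((z ⊛ oneS) ⊕ (z ⊛ A)) ⊕ zL²) ⊖ (z ⊛ A)
      ≈⟨ solve 2 (λ Z l → (((Z :* con 1ℚ) :+ (Z :* ((con 1ℚ :- Z) :* l))) :+ (((Z :* (con 1ℚ :- Z)) :* l) :* l))
                          :- (Z :* ((con 1ℚ :- Z) :* l))
                          := Z :+ (((Z :* (con 1ℚ :- Z)) :* l) :* l))
               (λ _ → refl) z L ⟩
    z ⊕ zL² ∎
    where
    open ≈ₛ-Reasoning
    A zL² : FPS
    A   = (oneS ⊖ z) ⊛ L
    zL² = ((z ⊛ (oneS ⊖ z)) ⊛ L) ⊛ L
    -- multiply the functional equation by 1 - z, using (1-z) · 1/(1-z) = 1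
    A-expanded : A ≈ₛ (((z ⊛ oneS) ⊕ (z ⊛ A)) ⊕ zL²)
    A-expanded = begin
      A ≈⟨ ⊛-cong {oneS ⊖ z} (λ _ → refl) L-eq ⟩
      (oneS ⊖ z) ⊛ (z ⊛ ((G ⊕ L) ⊕ (L ⊛ L)))
        ≈⟨ solve 3 (λ Z g l → (con 1ℚ :- Z) :* (Z :* ((g :+ l) :+ (l :* l)))
                   := ((Z :* ((con 1ℚ :- Z) :* g)) :+ (Z :* ((con 1ℚ :- Z) :* l))) :+ (((Z :* (con 1ℚ :- Z)) :* l) :* l))
                 (λ _ → refl) z G L ⟩
      ((z ⊛ ((oneS ⊖ z) ⊛ G)) ⊕ (z ⊛ A)) ⊕ zL²
        ≈⟨ (λ n → cong (λ x → (x +q (z ⊛ A) n) +q zL² n) (⊛-cong {z} (λ _ → refl) geometric-inverse n)) ⟩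
      ((z ⊛ oneS) ⊕ (z ⊛ A)) ⊕ zL² ∎

  -- 1 - z - 2zL, which times √(1-z) is the square root of P
  W : FPS
  W = (oneS ⊖ z) ⊖ ((constS (+ 2 / 1) ⊛ z) ⊛ L)

  -- the discriminant of the quadratic: (1-z) W² = (1-z)³ - 4z² = 1 - 3z - z² - z³
  discriminant : ((oneS ⊖ z) ⊛ (W ⊛ W)) ≈ₛ P
  discriminant = begin
    (oneS ⊖ z) ⊛ (W ⊛ W)
      ≈⟨ solve 2 (λ Z l → (con 1ℚ :- Z) :* (((con 1ℚ :- Z) :- ((con (+ 2 / 1) :* Z) :* l)) :* ((con 1ℚ :- Z) :- ((con (+ 2 / 1) :* Z) :* l)))
                 := ((((con 1ℚ :- Z) :* (con 1ℚ :- Z)) :* (con 1ℚ :- Z)) :- ((con (+ 4 / 1) :* Z) :* (((con 1ℚ :- Z) :* (con 1ℚ :- Z)) :* l)))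
                    :+ ((con (+ 4 / 1) :* Z) :* (((Z :* (con 1ℚ :- Z)) :* l) :* l)))
               (λ _ → refl) z L ⟩
    (cube ⊖ (four-z ⊛ (((oneS ⊖ z) ⊛ (oneS ⊖ z)) ⊛ L))) ⊕ (four-z ⊛ zL²)
      ≈⟨ (λ n → cong (λ x → (cube n -q x) +q (four-z ⊛ zL²) n) (⊛-cong {four-z} (λ _ → refl) quadratic n)) ⟩
    (cube ⊖ (four-z ⊛ (z ⊕ zL²))) ⊕ (four-z ⊛ zL²)
      ≈⟨ solve 2 (λ Z l → ((((con 1ℚ :- Z) :* (con 1ℚ :- Z)) :* (con 1ℚ :- Z))
                           :- ((con (+ 4 / 1) :* Z) :* (Z :+ (((Z :* (con 1ℚ :- Z)) :* l) :* l))))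
                          :+ ((con (+ 4 / 1) :* Z) :* (((Z :* (con 1ℚ :- Z)) :* l) :* l))
                 := con 1ℚ :+ Z :* (con (-[1+ 2 ] / 1) :+ Z :* (con (-[1+ 0 ] / 1) :+ Z :* (con (-[1+ 0 ] / 1) :+ Z :* con 0ℚ))))
               (λ _ → refl) z L ⟩
    horner (1ℚ ∷ (-[1+ 2 ] / 1) ∷ (-[1+ 0 ] / 1) ∷ (-[1+ 0 ] / 1) ∷ [])
      ≈⟨ (λ n → sym (poly≈horner (1ℚ ∷ (-[1+ 2 ] / 1) ∷ (-[1+ 0 ] / 1) ∷ (-[1+ 0 ] / 1) ∷ []) n)) ⟩
    P ∎
    where
    open ≈ₛ-Reasoning
    cube four-z zL² : FPS
    cube   = ((oneS ⊖ z) ⊛ (oneS ⊖ z)) ⊛ (oneS ⊖ z)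
    four-z = constS (+ 4 / 1) ⊛ z
    zL²    = ((z ⊛ (oneS ⊖ z)) ⊛ L) ⊛ L

  -- so sW has the same constant term as s
  W-zero : W 0 ≡ 1ℚ
  W-zero = begin
    W 0                                         ≡⟨ cong (1ℚ -q_) (⊛-at-zero (constS (+ 2 / 1) ⊛ z) L) ⟩
    1ℚ -q ((constS (+ 2 / 1) ⊛ z) 0 *q L 0)     ≡⟨ cong (λ x → 1ℚ -q (x *q L 0)) (constS-scale (+ 2 / 1) z 0) ⟩
    1ℚ -q (0ℚ *q L 0)                           ≡⟨ cong (1ℚ -q_) (ℚₚ.*-zeroˡ (L 0)) ⟩
    1ℚ                                          ∎
    where open ≡-Reasoning

  sqrt-P : ∀ s → (s ⊛ s) ≈ₛ oneMinusZ → ((s ⊛ W) ⊛ (s ⊛ W)) ≈ₛ P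
  sqrt-P s s²≈1-z = begin
    (s ⊛ W) ⊛ (s ⊛ W) ≈⟨ solve 2 (λ a w → (a :* w) :* (a :* w) := (a :* a) :* (w :* w)) (λ _ → refl) s W ⟩
    (s ⊛ s) ⊛ (W ⊛ W) ≈⟨ ⊛-cong {g = W ⊛ W} (λ n → trans (s²≈1-z n) (oneMinusZ≈1-z n)) (λ _ → refl) ⟩
    (oneS ⊖ z) ⊛ (W ⊛ W) ≈⟨ discriminant ⟩
    P ∎
    where open ≈ₛ-Reasoning

  sqrt-P-unique : ∀ s t → s 0 ≡ 1ℚ → (s ⊛ s) ≈ₛ oneMinusZ → t 0 ≡ 1ℚ → (t ⊛ t) ≈ₛ P → t ≈ₛ (s ⊛ W)
  sqrt-P-unique s t s0≡1 s²≈1-z t0≡1 t²≈P =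
    sqrt-unique t (s ⊛ W) (λ n → trans (t²≈P n) (sym (sqrt-P s s²≈1-z n)))
                (λ t0+sW0≡0 → 1+1≢0 (trans (cong₂ _+q_ (sym t0≡1) sW-zero) t0+sW0≡0))
    where
    1+1≢0 : 1ℚ +q 1ℚ ≢ 0ℚ
    1+1≢0 ()
    sW-zero : 1ℚ ≡ (s ⊛ W) 0
    sW-zero = sym (trans (⊛-at-zero s W) (cong₂ _*q_ s0≡1 W-zero))

  two : FPS
  two = constS (+ 2 / 1)

  -- with s = √(1-z), t = √P and v = 1/s we get v((1-z)s - t) = v(2zsL) = 2zL
  numerator : ∀ s t v → s 0 ≡ 1ℚ → (s ⊛ s) ≈ₛ oneMinusZ → t 0 ≡ 1ℚ → (t ⊛ t) ≈ₛ P → (v ⊛ s) ≈ₛ oneS →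
              (v ⊛ ((oneMinusZ ⊛ s) ⊖ t)) ≈ₛ (two ⊛ (z ⊛ L))
  numerator s t v s0≡1 s²≈1-z t0≡1 t²≈P vs≈1 = begin
    v ⊛ ((oneMinusZ ⊛ s) ⊖ t)
      ≈⟨ ⊛-cong {v} (λ _ → refl) (λ n → cong₂ _-q_ (⊛-cong {g = s} oneMinusZ≈1-z (λ _ → refl) n) (t≈sW n)) ⟩
    v ⊛ (((oneS ⊖ z) ⊛ s) ⊖ (s ⊛ W))
      ≈⟨ solve 4 (λ a b Z l → a :* (((con 1ℚ :- Z) :* b) :- (b :* ((con 1ℚ :- Z) :- ((con (+ 2 / 1) :* Z) :* l))))
                 := (a :* b) :* (con (+ 2 / 1) :* (Z :* l)))
               (λ _ → refl) v s z L ⟩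
    (v ⊛ s) ⊛ (two ⊛ (z ⊛ L)) ≈⟨ ⊛-cong {g = two ⊛ (z ⊛ L)} vs≈1 (λ _ → refl) ⟩
    oneS ⊛ (two ⊛ (z ⊛ L))    ≈⟨ ⊛-identityˡ (two ⊛ (z ⊛ L)) ⟩
    two ⊛ (z ⊛ L) ∎
    where
    open ≈ₛ-Reasoning
    t≈sW : t ≈ₛ (s ⊛ W)
    t≈sW = sqrt-P-unique s t s0≡1 s²≈1-z t0≡1 t²≈P

  closed-form : ∀ s t v → s 0 ≡ 1ℚ → (s ⊛ s) ≈ₛ oneMinusZ → t 0 ≡ 1ℚ → (t ⊛ t) ≈ₛ P → (v ⊛ s) ≈ₛ oneS →
                ∀ n → L n ≡ ½ *q (v ⊛ ((oneMinusZ ⊛ s) ⊖ t)) (suc n)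
  closed-form s t v s0≡1 s²≈1-z t0≡1 t²≈P vs≈1 n = sym (begin
    ½ *q (v ⊛ ((oneMinusZ ⊛ s) ⊖ t)) (suc n)  ≡⟨ cong (½ *q_) (numerator s t v s0≡1 s²≈1-z t0≡1 t²≈P vs≈1 (suc n)) ⟩
    ½ *q (two ⊛ (z ⊛ L)) (suc n)              ≡⟨ cong (½ *q_) (constS-scale (+ 2 / 1) (z ⊛ L) (suc n)) ⟩
    ½ *q ((+ 2 / 1) *q (z ⊛ L) (suc n))       ≡⟨ cong (λ x → ½ *q ((+ 2 / 1) *q x)) (z⊛-suc L n) ⟩
    ½ *q ((+ 2 / 1) *q L n)                   ≡⟨ sym (ℚₚ.*-assoc ½ (+ 2 / 1) (L n)) ⟩
    1ℚ *q L n                                 ≡⟨ ℚₚ.*-identityˡ (L n) ⟩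
    L n                                       ∎)
    where open ≡-Reasoning

Enumeration : Set → Set
Enumeration A = Σ ℕ (λ k → Fin k ↔ A)

count-unique : ∀ {A} (e e′ : Enumeration A) → proj₁ e ≡ proj₁ e′
count-unique (k , e) (k′ , e′) = ↔⇒≡ (↔-trans e (↔-sym e′))

enum-transport : ∀ {A B} → A ↔ B → Enumeration A → Enumeration B
enum-transport A↔B (k , e) = k , ↔-trans e A↔B

enum-⊤ : Enumeration ⊤
enum-⊤ = 1 , 1↔⊤

enum-⊎ : ∀ {A B} → Enumeration A → Enumeration B → Enumeration (A ⊎ B)
enum-⊎ (k , e) (l , f) = k + l , ↔-trans +↔⊎ (e ⊎-↔ f)

enum-× : ∀ {A B} → Enumeration A → Enumeration B → Enumeration (A × B)
enum-× (k , e) (l , f) = k * l , ↔-trans *↔× (e ×-↔ f)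

Σ< : ℕ → (ℕ → Set) → Set
Σ< m A = Σ ℕ (λ i → i < m × A i)

Σ<-zero : ∀ A → Fin 0 ↔ Σ< 0 A
Σ<-zero A = mk↔ₛ′ (λ ()) (λ { (_ , () , _) }) (λ { (_ , () , _) }) (λ ())

Σ<-suc : ∀ {m} A → (A 0 ⊎ Σ< m (λ i → A (suc i))) ↔ Σ< (suc m) A
Σ<-suc {m} A = mk↔ₛ′ to from to∘from from∘to
  where
  to : A 0 ⊎ Σ< m (λ i → A (suc i)) → Σ< (suc m) A
  to (inj₁ x)             = 0 , s≤s z≤n , x
  to (inj₂ (i , i<m , x)) = suc i , s≤s i<m , x
  from : Σ< (suc m) A → A 0 ⊎ Σ< m (λ i → A (suc i))
  from (zero  , _         , x) = inj₁ x
  from (suc i , s≤s i<m , x) = inj₂ (i , i<m , x)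
  to∘from : ∀ y → to (from y) ≡ y
  to∘from (zero  , 0<1+m     , x) = cong (λ p → 0 , p , x) (ℕₚ.≤-irrelevant _ _)
  to∘from (suc i , s≤s i<m , x) = refl
  from∘to : ∀ x → from (to x) ≡ x
  from∘to (inj₁ x) = refl
  from∘to (inj₂ y) = refl

enum-Σ< : ∀ m (A : ℕ → Set) → (∀ i → i < m → Enumeration (A i)) → Enumeration (Σ< m A)
enum-Σ< zero    A e = 0 , Σ<-zero A
enum-Σ< (suc m) A e =
  enum-transport (Σ<-suc A) (enum-⊎ (e 0 (s≤s z≤n)) (enum-Σ< m (λ i → A (suc i)) (λ i i<m → e (suc i) (s≤s i<m))))

sumℕTo : ℕ → (ℕ → ℕ) → ℕ
sumℕTo zero    h = 0
sumℕTo (suc n) h = h 0 + sumℕTo n (λ i → h (suc i))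

enum-Σ<-count : ∀ m A e (h : ℕ → ℕ) → (∀ i i<m → proj₁ (e i i<m) ≡ h i) → proj₁ (enum-Σ< m A e) ≡ sumℕTo m h
enum-Σ<-count zero    A e h eh = refl
enum-Σ<-count (suc m) A e h eh =
  cong₂ _+_ (eh 0 (s≤s z≤n))
            (enum-Σ<-count m (λ i → A (suc i)) (λ i i<m → e (suc i) (s≤s i<m)) (λ i → h (suc i)) (λ i i<m → eh (suc i) (s≤s i<m)))

-- sizes are written m + 1, so these replace injectivity and non-vanishing of suc
+1-injective : ∀ {a b} → a + 1 ≡ suc b → a ≡ b
+1-injective {a} a+1≡1+b = ℕₚ.suc-injective (trans (ℕₚ.+-comm 1 a) a+1≡1+b)

+1≢0 : ∀ a → a + 1 ≢ 0
+1≢0 a a+1≡0 = ℕₚ.1+n≢0 (trans (ℕₚ.+-comm 1 a) a+1≡0)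

-- the de Bruijn index of size n + 1
idx : ℕ → Idx
idx zero    = 𝟘
idx (suc n) = S (idx n)

idx-size : ∀ n → sizeIdx (idx n) ≡ suc n
idx-size zero    = refl
idx-size (suc n) = trans (cong (_+ 1) (idx-size n)) (ℕₚ.+-comm (suc n) 1)

idx-unique : ∀ x n → sizeIdx x ≡ suc n → x ≡ idx n
idx-unique 𝟘     zero    _    = refl
idx-unique 𝟘     (suc n) ()
idx-unique (S y) zero    size≡1 = ⊥-elim (positive y (+1-injective size≡1))
  where
  positive : ∀ y → sizeIdx y ≢ 0
  positive 𝟘     ()
  positive (S y) = +1≢0 (sizeIdx y)
idx-unique (S y) (suc n) size≡ = cong S (idx-unique y n (+1-injective size≡))

size-positive : ∀ t → size t ≢ 0
size-positive (var 𝟘)     ()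
size-positive (var (S y)) = +1≢0 (sizeIdx y)
size-positive (lam t)     = +1≢0 (size t)
size-positive (app t u)   = +1≢0 (size t + size u)

-- Two sized terms are equal as soon as the terms are: sizes are proof-irrelevant.
sized-≡ : ∀ {a b : Term} {n} → a ≡ b → (p : size a ≡ n) (q : size b ≡ n) → _≡_ {A = TermsOfSize n} (a , p) (b , q)
sized-≡ refl p q = cong (_ ,_) (ℕₚ.≡-irrelevant p q)

Splits : ℕ → Set
Splits n = Σ< (suc n) (λ i → TermsOfSize i × TermsOfSize (n ∸ i))

term-decomposition : ∀ n → TermsOfSize (suc n) ↔ ((⊤ ⊎ TermsOfSize n) ⊎ Splits n)
term-decomposition n = mk↔ₛ′ to from to∘from from∘to
  where
  to : TermsOfSize (suc n) → (⊤ ⊎ TermsOfSize n) ⊎ Splits n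
  to (var x   , _)        = inj₁ (inj₁ tt)
  to (lam t   , size≡)    = inj₁ (inj₂ (t , +1-injective size≡))
  to (app t u , size≡)    =
    inj₂ (size t , s≤s (subst (size t ≤_) tu≡n (ℕₚ.m≤m+n (size t) (size u))) , (t , refl) ,
          (u , trans (sym (ℕₚ.m+n∸m≡n (size t) (size u))) (cong (_∸ size t) tu≡n)))
    where tu≡n = +1-injective size≡
  from : (⊤ ⊎ TermsOfSize n) ⊎ Splits n → TermsOfSize (suc n)
  from (inj₁ (inj₁ tt))       = var (idx n) , idx-size n
  from (inj₁ (inj₂ (t , t≡n))) = lam t , trans (cong (_+ 1) t≡n) (ℕₚ.+-comm n 1)
  from (inj₂ (i , i<1+n , (t , t≡i) , (u , u≡n-i))) =
    app t u , trans (cong₂ (λ a b → a + b + 1) t≡i u≡n-i)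
                    (trans (cong (_+ 1) (ℕₚ.m+[n∸m]≡n (ℕₚ.m<1+n⇒m≤n i<1+n))) (ℕₚ.+-comm n 1))
  to∘from : ∀ y → to (from y) ≡ y
  to∘from (inj₁ (inj₁ tt))      = refl
  to∘from (inj₁ (inj₂ (t , _))) = cong (λ p → inj₁ (inj₂ (t , p))) (ℕₚ.≡-irrelevant _ _)
  to∘from (inj₂ (i , _ , (t , refl) , (u , _))) =
    cong₂ (λ p q → inj₂ (size t , p , (t , refl) , (u , q))) (ℕₚ.≤-irrelevant _ _) (ℕₚ.≡-irrelevant _ _)
  from∘to : ∀ x → from (to x) ≡ x
  from∘to (var x   , size≡) = sized-≡ (cong var (sym (idx-unique x n size≡))) _ size≡
  from∘to (lam t   , size≡) = sized-≡ refl _ size≡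
  from∘to (app t u , size≡) = sized-≡ refl _ size≡

no-terms-of-size-0 : Enumeration (TermsOfSize 0)
no-terms-of-size-0 =
  0 , mk↔ₛ′ (λ ()) (λ { (t , p) → ⊥-elim (size-positive t p) }) (λ { (t , p) → ⊥-elim (size-positive t p) }) (λ ())

-- both components of a split are smaller than n + 1
split-fibres : ∀ n → (∀ {i} → i < suc n → Enumeration (TermsOfSize i)) →
               ∀ i → i < suc n → Enumeration (TermsOfSize i × TermsOfSize (n ∸ i))
split-fibres n below i i<1+n = enum-× (below i<1+n) (below (s≤s (ℕₚ.m∸n≤m n i)))

enumerate-suc : ∀ n → (∀ {i} → i < suc n → Enumeration (TermsOfSize i)) → Enumeration (TermsOfSize (suc n))
enumerate-suc n below =
  enum-transport (↔-sym (term-decomposition n))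
    (enum-⊎ (enum-⊎ enum-⊤ (below (ℕₚ.n<1+n n))) (enum-Σ< (suc n) _ (split-fibres n below)))

enumerate : ∀ n → Enumeration (TermsOfSize n)
enumerate = <-rec (λ n → Enumeration (TermsOfSize n)) step
  where
  step : ∀ n → (∀ {i} → i < n → Enumeration (TermsOfSize i)) → Enumeration (TermsOfSize n)
  step zero    _     = no-terms-of-size-0
  step (suc n) below = enumerate-suc n below

ℓ : ℕ → ℕ
ℓ n = proj₁ (enumerate n)

ℓ-zero : ℓ 0 ≡ 0
ℓ-zero = count-unique (enumerate 0) no-terms-of-size-0

-- ℓ (n+1) = 1 + ℓ n + Σ_{i≤n} ℓ i ℓ (n-i), comparing two enumerations of the same type
ℓ-suc : ∀ n → ℓ (suc n) ≡ (1 + ℓ n) + sumℕTo (suc n) (λ i → ℓ i * ℓ (n ∸ i))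
ℓ-suc n =
  trans (count-unique (enumerate (suc n)) (enumerate-suc n (λ {i} _ → enumerate i)))
        (cong (_+_ (1 + ℓ n)) (enum-Σ<-count (suc n) _ (split-fibres n (λ {i} _ → enumerate i)) (λ i → ℓ i * ℓ (n ∸ i)) (λ _ _ → refl)))

ι : ℕ → ℚ
ι n = + n / 1

ι-suc : ∀ n → ι (suc n) ≡ 1ℚ +q ι n
ι-suc n = trans (cong (λ k → (+ 1 ℤ.+ k) / 1) (sym (ℤₚ.*-identityʳ (+ n))))
                (cong (1ℚ +q_) (sym (ℚₚ.normalize-coprime (Coprimality.sym (Coprimality.1-coprimeTo n)))))

ι-+ : ∀ a b → ι (a + b) ≡ ι a +q ι b
ι-+ zero    b = sym (ℚₚ.+-identityˡ (ι b))
ι-+ (suc a) b = begin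
  ι (suc (a + b))       ≡⟨ ι-suc (a + b) ⟩
  1ℚ +q ι (a + b)       ≡⟨ cong (1ℚ +q_) (ι-+ a b) ⟩
  1ℚ +q (ι a +q ι b)    ≡⟨ sym (ℚₚ.+-assoc 1ℚ (ι a) (ι b)) ⟩
  (1ℚ +q ι a) +q ι b    ≡⟨ cong (_+q ι b) (sym (ι-suc a)) ⟩
  ι (suc a) +q ι b      ∎
  where open ≡-Reasoning

ι-* : ∀ a b → ι (a * b) ≡ ι a *q ι b
ι-* zero    b = sym (ℚₚ.*-zeroˡ (ι b))
ι-* (suc a) b = begin
  ι (b + a * b)            ≡⟨ ι-+ b (a * b) ⟩
  ι b +q ι (a * b)         ≡⟨ cong (ι b +q_) (ι-* a b) ⟩
  ι b +q ι a *q ι b        ≡⟨ cong (_+q ι a *q ι b) (sym (ℚₚ.*-identityˡ (ι b))) ⟩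
  1ℚ *q ι b +q ι a *q ι b  ≡⟨ sym (ℚₚ.*-distribʳ-+ (ι b) 1ℚ (ι a)) ⟩
  (1ℚ +q ι a) *q ι b       ≡⟨ cong (_*q ι b) (sym (ι-suc a)) ⟩
  ι (suc a) *q ι b         ∎
  where open ≡-Reasoning

ι-sum : ∀ n h → ι (sumℕTo n h) ≡ sumTo n (λ i → ι (h i))
ι-sum zero    h = refl
ι-sum (suc n) h = trans (ι-+ (h 0) _) (cong (ι (h 0) +q_) (ι-sum n (λ i → h (suc i))))

L∞ : FPS
L∞ n = ι (ℓ n)

L∞-equation : L∞ ≈ₛ (z ⊛ ((G ⊕ L∞) ⊕ (L∞ ⊛ L∞)))
L∞-equation zero    = trans (cong ι ℓ-zero) (sym (z⊛-zero ((G ⊕ L∞) ⊕ (L∞ ⊛ L∞))))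
L∞-equation (suc n) = begin
  ι (ℓ (suc n))
    ≡⟨ cong ι (ℓ-suc n) ⟩
  ι ((1 + ℓ n) + sumℕTo (suc n) (λ i → ℓ i * ℓ (n ∸ i)))
    ≡⟨ ι-+ (suc (ℓ n)) _ ⟩
  ι (suc (ℓ n)) +q ι (sumℕTo (suc n) (λ i → ℓ i * ℓ (n ∸ i)))
    ≡⟨ cong₂ _+q_ (ι-suc (ℓ n)) (ι-sum (suc n) (λ i → ℓ i * ℓ (n ∸ i))) ⟩
  (1ℚ +q L∞ n) +q sumTo (suc n) (λ i → ι (ℓ i * ℓ (n ∸ i)))
    ≡⟨ cong ((1ℚ +q L∞ n) +q_) (sumTo-cong (suc n) (λ i _ → ι-* (ℓ i) (ℓ (n ∸ i)))) ⟩
  (1ℚ +q L∞ n) +q conv L∞ L∞ n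
    ≡⟨ cong ((1ℚ +q L∞ n) +q_) (sym (⊛≡conv L∞ L∞ n)) ⟩
  ((G ⊕ L∞) ⊕ (L∞ ⊛ L∞)) n
    ≡⟨ sym (z⊛-suc ((G ⊕ L∞) ⊕ (L∞ ⊛ L∞)) n) ⟩
  (z ⊛ ((G ⊕ L∞) ⊕ (L∞ ⊛ L∞))) (suc n) ∎
  where open ≡-Reasoning

mainTheorem2 : (s t v : FPS) →
    s 0 ≡ 1ℚ → (s ⊛ s) ≈ₛ oneMinusZ →
    t 0 ≡ 1ℚ → (t ⊛ t) ≈ₛ P →
    (v ⊛ s) ≈ₛ oneS →
    (n : ℕ) → Σ ℕ (λ k → (Fin k ↔ TermsOfSize n) ×
      ((+ k / 1) ≡ ½ *q (v ⊛ ((oneMinusZ ⊛ s) ⊖ t)) (suc n)))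
mainTheorem2 s t v s0≡1 s²≈1-z t0≡1 t²≈P vs≈1 n =
  ℓ n , proj₂ (enumerate n) , closed-form s t v s0≡1 s²≈1-z t0≡1 t²≈P vs≈1 n
  where open FunctionalEquation L∞ L∞-equation
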